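{- If $q$ is an odd prime power, then $\mathcal C(\frac{q+1}{2},q^2)$ is a $2$-weight irreducible cyclic code.
   Context: Let $q=p^a$ with $p$ prime. For $k\mid q^2-1$ and $n=\frac{q^2-1}{k}$, $\mathcal C(k,q^2)=\{(\mathrm{Tr}_{q^2/p}(\gamma\,\omega^{ki}))_{i=0}^{n-1}:\gamma\in\mathbb F_{q^2}\}$, where $\omega$ is a primitive element of $\mathbb F_{q^2}$; this is a $p$-ary code. A $2$-weight code is one with exactly two distinct nonzero weights (Hamming weights). -}

module Defs where

open import Data.Nat as ℕ using (ℕ; zero; suc)
open import Data.Fin as Fin using (Fin; toℕ)
open import Data.List using (List; length)
open import Data.List.Membership.Propositional using (_∈_)
open import Data.List.Relation.Unary.Unique.Propositional using (Unique)
open import Data.Product using (Σ; ∃; _×_; _,_)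
open import Data.Sum using (_⊎_)
open import Relation.Nullary using (¬_; Dec; yes; no)
open import Relation.Binary.PropositionalEquality using (_≡_; _≢_)
open import Algebra.Structures using (IsCommutativeRing)

record Field : Set₁ where
  infixl 7 _*_
  infixl 6 _+_
  field
    Carrier : Set
    _+_ _*_ : Carrier → Carrier → Carrier
    -_      : Carrier → Carrier
    0# 1#   : Carrier
    isCommutativeRing : IsCommutativeRing _≡_ _+_ _*_ -_ 0# 1#
    0≢1     : 0# ≢ 1#
    inverse : ∀ x → x ≢ 0# → Σ Carrier λ y → x * y ≡ 1#
    _≟_     : (x y : Carrier) → Dec (x ≡ y)

  _^_ : Carrier → ℕ → Carrier
  x ^ zero  = 1#
  x ^ suc m = x * (x ^ m)

HasSize : Field → ℕ → Set
HasSize F N = Σ (List Carrier) λ xs →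
  (∀ x → x ∈ xs) × Unique xs × length xs ≡ N
  where open Field F

IsPrimitive : (F : Field) → ℕ → Field.Carrier F → Set
IsPrimitive F N ω = ω ^ (N ℕ.∸ 1) ≡ 1# × (∀ j → 0 ℕ.< j → j ℕ.< N ℕ.∸ 1 → ω ^ j ≢ 1#)
  where open Field F

module _ (F : Field) where
  open Field F

  sumTo : ℕ → (ℕ → Carrier) → Carrier
  sumTo zero    f = 0#
  sumTo (suc m) f = sumTo m f + f m

  trace : (p e : ℕ) → Carrier → Carrier
  trace p e x = sumTo e (λ j → x ^ (p ℕ.^ j))

  weight : (n : ℕ) → (Fin n → Carrier) → ℕ
  weight zero    c = 0
  weight (suc n) c with c Fin.zero ≟ 0#
  ... | yes _ = weight n (λ i → c (Fin.suc i))
  ... | no  _ = suc (weight n (λ i → c (Fin.suc i)))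


  -- the codeword (Tr_{q^2/p}(γ ω^{k i}))_{i=0}^{n-1}, where q^2 = p^e
  codeword : (p e : ℕ) (ω : Carrier) (k n : ℕ) (γ : Carrier) → Fin n → Carrier
  codeword p e ω k n γ i = trace p e (γ * (ω ^ (k ℕ.* toℕ i)))

  IsZeroWord : {n : ℕ} → (Fin n → Carrier) → Set
  IsZeroWord c = ∀ i → c i ≡ 0#

  -- A code given as the image {cw γ : γ ∈ F} is a 2-weight code: the set of weights of
  -- its nonzero codewords has exactly two elements.
  IsTwoWeight : (n : ℕ) → (Carrier → Fin n → Carrier) → Set
  IsTwoWeight n cw = Σ ℕ λ w₁ → Σ ℕ λ w₂ → w₁ ≢ w₂
    × (∀ γ → ¬ IsZeroWord (cw γ) → weight n (cw γ) ≡ w₁ ⊎ weight n (cw γ) ≡ w₂)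
    × (Σ Carrier λ γ → ¬ IsZeroWord (cw γ) × weight n (cw γ) ≡ w₁)
    × (Σ Carrier λ γ → ¬ IsZeroWord (cw γ) × weight n (cw γ) ≡ w₂)

module Submission where

-- Put M = q - 1, g_m = ω^((q+1)m) (these run through F_q^*, M-periodically) and ζ = ω^k.
-- The even positions 2m of the codeword of γ carry Tr(γ g_m), the odd ones Tr(γζ g_m).
-- Because g_m ∈ F_q, Tr_{q²/p}(y g_m) = Tr_{q/p}(U(y) g_m) with U(y) = y + y^q ∈ F_q, so
--     weight(γ) = B(U γ) + B(U (γζ)),   B(u) = #{m < M | Tr_{q/p}(u g_m) ≠ 0}.
-- For u ∈ F_q^* multiplication by u shifts the cyclic sequence g, so B(u) = c := B(1),
-- while B(0) = 0; hence every weight is 0, c or 2c. c ≠ 0 because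
-- Σ_m g_m^(q-2) Tr_{q/p}(g_m) = M ≠ 0 in F (a sum of geometric sums over F_q^*).
-- Finally ζ^(q-1) = -1, so γ = 1 has weight c and γ = 1 + ζ has weight 2c (p odd gives 2 ≠ 0).

open import Defs
open import Algebra.Bundles using (CommutativeRing)
open import Data.Empty using (⊥; ⊥-elim)
open import Data.Fin as Fin using (Fin; toℕ; inject₁; fromℕ)
open import Data.Fin.Permutation using (permutation)
open import Data.Fin.Properties using (toℕ-inject₁; toℕ<n; toℕ-fromℕ; pigeonhole)
open import Data.List using (List; _∷_; length; lookup)
open import Data.List.Membership.Propositional.Properties using (∈-lookup)
open import Data.List.Relation.Unary.All as All using ()
open import Data.List.Relation.Unary.AllPairs using (_∷_)
open import Data.List.Relation.Unary.Any as Any using ()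
open import Data.List.Relation.Unary.Any.Properties using (lookup-index)
open import Data.List.Relation.Unary.Unique.Propositional using (Unique)
open import Data.Nat as ℕ using (ℕ; zero; suc; z≤n; s≤s; _∸_; _!; NonZero)
import Data.Nat.Properties as ℕP
open import Data.Nat.Combinatorics using (_C_; k![n∸k]!∣n!; nCn≡1)
open import Data.Nat.Combinatorics.Specification using (nCk≡n!/k![n-k]!)
open import Data.Nat.Divisibility
  using (_∣_; divides; ∣⇒≤; m∣m*n; ∣1⇒≡1; m%n≡0⇒n∣m; *-cancelˡ-∣; *-cancelʳ-∣; ∣m+n∣m⇒∣n)
open import Data.Nat.DivMod using (_%_; _/_; m≡m%n+[m/n]*n; m%n<n; m/n*n≡m)
open import Data.Nat.Primality
  using (Prime; euclidsLemma; prime⇒irreducible; prime⇒nonZero; prime⇒nonTrivial)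
open import Data.Nat.Tactic.RingSolver using (solve-∀)
open import Data.Product using (Σ; _,_; proj₁; proj₂)
open import Data.Sum using (_⊎_; inj₁; inj₂)
open import Relation.Nullary using (¬_; yes; no)
open import Relation.Binary.PropositionalEquality

module NatLemmas where

  m≤m^n : ∀ m n → 0 ℕ.< m → 0 ℕ.< n → m ℕ.≤ m ℕ.^ n
  m≤m^n m (suc n) 0<m _ =
    subst (ℕ._≤ m ℕ.* m ℕ.^ n) (ℕP.*-identityʳ m) (ℕP.*-monoʳ-≤ m (ℕP.m^n>0 m n))
    where instance _ = ℕ.>-nonZero 0<m

  oddPrime : ∀ {p} → Prime p → p ≢ 2 → Σ ℕ λ t → p ≡ suc (t ℕ.* 2)
  oddPrime {p} pp p≢2 = by-remainder (p % 2) (m%n<n p 2) (m≡m%n+[m/n]*n p 2)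
    where
    by-remainder : ∀ r → r ℕ.< 2 → p ≡ r ℕ.+ (p / 2) ℕ.* 2 → Σ ℕ λ t → p ≡ suc (t ℕ.* 2)
    by-remainder zero _ p≡2t with prime⇒irreducible pp (divides (p / 2) p≡2t)
    ... | inj₁ ()
    ... | inj₂ 2≡p = ⊥-elim (p≢2 (sym 2≡p))
    by-remainder (suc zero)    _               p≡1+2t = p / 2 , p≡1+2t
    by-remainder (suc (suc _)) (s≤s (s≤s ())) _

  -- M does not divide (M - 1) + P when 1 < P ≤ M: the sum lies strictly between M and 2M.
  ∤-pred+ : ∀ M P → 1 ℕ.< P → P ℕ.≤ M → ¬ (M ∣ (M ∸ 1) ℕ.+ P)
  ∤-pred+ M       zero          ()        _
  ∤-pred+ M       (suc zero)    (s≤s ())  _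
  ∤-pred+ zero    (suc (suc P)) _         ()
  ∤-pred+ (suc M) (suc (suc P)) _         P≤M M∣ =
    ℕP.<⇒≱ P≤M (∣⇒≤ (∣m+n∣m⇒∣n M∣M+P (divides 1 (sym (ℕP.*-identityˡ _)))))
    where
    M∣M+P : suc M ∣ suc M ℕ.+ suc P
    M∣M+P = subst (suc M ∣_) (ℕP.+-suc M (suc P)) M∣

  n∣n! : ∀ n → 0 ℕ.< n → n ∣ n !
  n∣n! (suc n) _ = m∣m*n (n !)

  double : ℕ → ℕ
  double zero    = 0
  double (suc m) = suc (suc (double m))

  double≡ : ∀ m → double m ≡ m ℕ.+ m
  double≡ zero    = refl
  double≡ (suc m) = cong suc (trans (cong suc (double≡ m)) (sym (ℕP.+-suc m m)))

open NatLemmas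

module FieldLemmas (F : Field) where
  open Field F public

  commutativeRing : CommutativeRing _ _
  commutativeRing = record { isCommutativeRing = isCommutativeRing }

  open CommutativeRing commutativeRing public using
    (+-assoc; +-comm; +-identityˡ; +-identityʳ; *-assoc; *-comm; *-identityˡ; *-identityʳ;
     distribˡ; distribʳ; zeroˡ; zeroʳ; -‿inverseʳ; -‿inverseˡ; semiring; commutativeSemiring;
     +-commutativeMonoid)
  open import Algebra.Properties.Group (CommutativeRing.+-group commutativeRing) public
    using (∙-cancelʳ; identityʳ-unique)
  open import Algebra.Solver.Ring.NaturalCoefficients.Default commutativeSemiring public
  open import Algebra.Properties.Semiring.Mult semiring public using (_×_; ×1-homo-*; ×-assoc-*)

  ι : ℕ → Carrier
  ι n = n × 1#

  noZeroDivisors : ∀ x y → x * y ≡ 0# → x ≡ 0# ⊎ y ≡ 0#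
  noZeroDivisors x y xy≡0 with x ≟ 0#
  ... | yes x≡0 = inj₁ x≡0
  ... | no x≢0 with inverse x x≢0
  ... | (x⁻¹ , xx⁻¹≡1) = inj₂ (begin
      y                ≡⟨ sym (*-identityˡ y) ⟩
      1# * y           ≡⟨ cong (_* y) (trans (sym xx⁻¹≡1) (*-comm x x⁻¹)) ⟩
      (x⁻¹ * x) * y    ≡⟨ *-assoc x⁻¹ x y ⟩
      x⁻¹ * (x * y)    ≡⟨ cong (x⁻¹ *_) xy≡0 ⟩
      x⁻¹ * 0#         ≡⟨ zeroʳ x⁻¹ ⟩
      0#               ∎)
    where open ≡-Reasoning

  *-≢0 : ∀ {x y} → x ≢ 0# → y ≢ 0# → x * y ≢ 0#
  *-≢0 {x} {y} x≢0 y≢0 xy≡0 with noZeroDivisors x y xy≡0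
  ... | inj₁ x≡0 = x≢0 x≡0
  ... | inj₂ y≡0 = y≢0 y≡0

  *-cancelʳ : ∀ x y z → z ≢ 0# → x * z ≡ y * z → x ≡ y
  *-cancelʳ x y z z≢0 eq with inverse z z≢0
  ... | (z⁻¹ , zz⁻¹≡1) = begin
      x                ≡⟨ sym (*-identityʳ x) ⟩
      x * 1#           ≡⟨ cong (x *_) (sym zz⁻¹≡1) ⟩
      x * (z * z⁻¹)    ≡⟨ sym (*-assoc x z z⁻¹) ⟩
      (x * z) * z⁻¹    ≡⟨ cong (_* z⁻¹) eq ⟩
      (y * z) * z⁻¹    ≡⟨ *-assoc y z z⁻¹ ⟩
      y * (z * z⁻¹)    ≡⟨ cong (y *_) zz⁻¹≡1 ⟩
      y * 1#           ≡⟨ *-identityʳ y ⟩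
      y                ∎
    where open ≡-Reasoning

  *-cancelˡ : ∀ x y z → z ≢ 0# → z * x ≡ z * y → x ≡ y
  *-cancelˡ x y z z≢0 eq = *-cancelʳ x y z z≢0 (trans (*-comm x z) (trans eq (*-comm z y)))

  ^-+ : ∀ x m n → x ^ (m ℕ.+ n) ≡ x ^ m * x ^ n
  ^-+ x zero    n = sym (*-identityˡ _)
  ^-+ x (suc m) n = trans (cong (x *_) (^-+ x m n)) (sym (*-assoc x _ _))

  ^-* : ∀ x m n → x ^ (m ℕ.* n) ≡ (x ^ m) ^ n
  ^-* x m zero    = cong (x ^_) (ℕP.*-zeroʳ m)
  ^-* x m (suc n) = begin
      x ^ (m ℕ.* suc n)        ≡⟨ cong (x ^_) (ℕP.*-suc m n) ⟩
      x ^ (m ℕ.+ m ℕ.* n)      ≡⟨ ^-+ x m (m ℕ.* n) ⟩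
      x ^ m * x ^ (m ℕ.* n)    ≡⟨ cong (x ^ m *_) (^-* x m n) ⟩
      x ^ m * (x ^ m) ^ n      ∎
    where open ≡-Reasoning

  *-^ : ∀ x y n → (x * y) ^ n ≡ x ^ n * y ^ n
  *-^ x y zero    = sym (*-identityˡ 1#)
  *-^ x y (suc n) = trans (cong ((x * y) *_) (*-^ x y n))
    (solve 4 (λ x y a b → (x :* y) :* (a :* b) := (x :* a) :* (y :* b)) refl x y (x ^ n) (y ^ n))

  1^ : ∀ n → 1# ^ n ≡ 1#
  1^ zero    = refl
  1^ (suc n) = trans (*-identityˡ _) (1^ n)

  0^ : ∀ n → 0 ℕ.< n → 0# ^ n ≡ 0#
  0^ (suc n) _ = zeroˡ _

  ^≢0 : ∀ x n → x ≢ 0# → x ^ n ≢ 0#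
  ^≢0 x zero    x≢0 1≡0 = 0≢1 (sym 1≡0)
  ^≢0 x (suc n) x≢0     = *-≢0 x≢0 (^≢0 x n x≢0)

  ^≡0 : ∀ x n → x ^ n ≡ 0# → x ≡ 0#
  ^≡0 x n xⁿ≡0 with x ≟ 0#
  ... | yes x≡0 = x≡0
  ... | no x≢0  = ⊥-elim (^≢0 x n x≢0 xⁿ≡0)

  ι-* : ∀ m n → ι (m ℕ.* n) ≡ ι m * ι n
  ι-* = ×1-homo-*

  ι-^ : ∀ m n → ι (m ℕ.^ n) ≡ ι m ^ n
  ι-^ m zero    = +-identityʳ 1#
  ι-^ m (suc n) = trans (ι-* m (m ℕ.^ n)) (cong (ι m *_) (ι-^ m n))

  ι≡0⇒×≡0 : ∀ n z → ι n ≡ 0# → n × z ≡ 0#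
  ι≡0⇒×≡0 n z ιn≡0 = begin
      n × z           ≡⟨ cong (n ×_) (sym (*-identityˡ z)) ⟩
      n × (1# * z)    ≡⟨ sym (×-assoc-* n 1# z) ⟩
      ι n * z         ≡⟨ cong (_* z) ιn≡0 ⟩
      0# * z          ≡⟨ zeroˡ z ⟩
      0#              ∎
    where open ≡-Reasoning

  ι-consecutive : ∀ m → ι (suc m) ≡ 0# → ι m ≢ 0#
  ι-consecutive m ι[1+m]≡0 ιm≡0 =
    0≢1 (sym (trans (sym (+-identityʳ 1#)) (trans (cong (1# +_) (sym ιm≡0)) ι[1+m]≡0)))

-- For a prime p and 0 < k < p, p divides the binomial coefficient p C k: it divides
-- p! = (p C k) · k! · (p - k)! but neither k! nor (p - k)!, whose factors are all below p.
module PrimeBinomial (p : ℕ) (pp : Prime p) where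

  1<p : 1 ℕ.< p
  1<p = ℕ.nonTrivial⇒n>1 p {{prime⇒nonTrivial pp}}

  p∤small : ∀ m → 0 ℕ.< m → m ℕ.< p → ¬ (p ∣ m)
  p∤small (suc m) _ m<p p∣m = ℕP.<⇒≱ m<p (∣⇒≤ p∣m)

  p∤factorial : ∀ m → m ℕ.< p → ¬ (p ∣ m !)
  p∤factorial zero    _   p∣1 = ℕP.<⇒≢ 1<p (sym (∣1⇒≡1 p∣1))
  p∤factorial (suc m) m<p p∣m! with euclidsLemma (suc m) (m !) pp p∣m!
  ... | inj₁ p∣1+m = p∤small (suc m) (s≤s z≤n) m<p p∣1+m
  ... | inj₂ p∣m!' = p∤factorial m (ℕP.<-trans (ℕP.n<1+n m) m<p) p∣m!'

  p∣factorisation : ∀ k → k ℕ.≤ p → p ∣ (p C k) ℕ.* (k ! ℕ.* (p ∸ k) !)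
  p∣factorisation k k≤p = subst (p ∣_) (sym factorisation) (n∣n! p (ℕP.<-trans (s≤s z≤n) 1<p))
    where
    factorisation : (p C k) ℕ.* (k ! ℕ.* (p ∸ k) !) ≡ p !
    factorisation = trans (cong (ℕ._* (k ! ℕ.* (p ∸ k) !)) (nCk≡n!/k![n-k]! k≤p))
                          (m/n*n≡m {{ℕP._!*_!≢0 k (p ∸ k)}} (k![n∸k]!∣n! k≤p))

  p∣pCk : ∀ k → 0 ℕ.< k → k ℕ.< p → p ∣ p C k
  p∣pCk k 0<k k<p with euclidsLemma (p C k) _ pp (p∣factorisation k (ℕP.<⇒≤ k<p))
  ... | inj₁ p∣C    = p∣C
  ... | inj₂ p∣rest with euclidsLemma (k !) ((p ∸ k) !) pp p∣rest
  ... | inj₁ p∣k!       = ⊥-elim (p∤factorial k k<p p∣k!)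
  ... | inj₂ p∣[p-k]!   = ⊥-elim (p∤factorial (p ∸ k) (ℕP.∸-monoʳ-< 0<k (ℕP.<⇒≤ k<p)) p∣[p-k]!)

module FreshmansDream (F : Field) where
  open FieldLemmas F
  import Algebra.Properties.CommutativeSemiring.Binomial commutativeSemiring as Binomial
  import Algebra.Properties.Semiring.Exp semiring as Exp
  import Algebra.Properties.Semiring.Sum semiring as Sum

  ^-lib : ∀ x n → x Exp.^ n ≡ x ^ n
  ^-lib x zero    = refl
  ^-lib x (suc n) = cong (x *_) (^-lib x n)

  sum-last : ∀ {m} (f : Fin (suc m) → Carrier) → (∀ (i : Fin m) → f (inject₁ i) ≡ 0#) →
             Sum.sum f ≡ f (fromℕ m)
  sum-last {zero}  f _    = +-identityʳ _
  sum-last {suc m} f init = trans (cong (_+ Sum.sum (λ i → f (Fin.suc i))) (init Fin.zero))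
    (trans (+-identityˡ _) (sum-last (λ i → f (Fin.suc i)) (λ i → init (Fin.suc i))))

  freshman : ∀ n → 0 ℕ.< n → (∀ k → 0 ℕ.< k → k ℕ.< n → ι (n C k) ≡ 0#) →
             ∀ x y → (x + y) ^ n ≡ x ^ n + y ^ n
  freshman (suc m) _ inner≡0 x y = begin
      (x + y) ^ suc m                            ≡⟨ sym (^-lib (x + y) (suc m)) ⟩
      (x + y) Exp.^ suc m                        ≡⟨ Binomial.theorem (suc m) x y ⟩
      term Fin.zero + Sum.sum (λ i → term (Fin.suc i))
        ≡⟨ cong₂ _+_ first (sum-last (λ i → term (Fin.suc i)) middle) ⟩
      y ^ suc m + term (Fin.suc (fromℕ m))       ≡⟨ cong (y ^ suc m +_) last ⟩
      y ^ suc m + x ^ suc m                      ≡⟨ +-comm _ _ ⟩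
      x ^ suc m + y ^ suc m                      ∎
    where
    open ≡-Reasoning
    term = Binomial.binomialTerm x y (suc m)
    first : term Fin.zero ≡ y ^ suc m
    first = trans (+-identityʳ _) (trans (*-identityˡ _) (^-lib y (suc m)))
    middle : ∀ (i : Fin m) → term (Fin.suc (inject₁ i)) ≡ 0#
    middle i = ι≡0⇒×≡0 (suc m C suc (toℕ (inject₁ i))) (Binomial.binomial x y (suc m) (Fin.suc (inject₁ i)))
                 (inner≡0 (suc (toℕ (inject₁ i))) (s≤s z≤n)
                 (s≤s (subst (ℕ._< m) (sym (toℕ-inject₁ i)) (toℕ<n i))))
    last : term (Fin.suc (fromℕ m)) ≡ x ^ suc m
    last rewrite toℕ-fromℕ m | nCn≡1 (suc m) | ℕP.n∸n≡0 m =
      trans (+-identityʳ _) (trans (*-identityʳ _) (^-lib x (suc m)))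

module Frobenius (F : Field) (p : ℕ) (pp : Prime p) (ιp≡0 : FieldLemmas.ι F p ≡ Field.0# F) where
  open FieldLemmas F
  open PrimeBinomial p pp
  open FreshmansDream F

  ι-pCk≡0 : ∀ k → 0 ℕ.< k → k ℕ.< p → ι (p C k) ≡ 0#
  ι-pCk≡0 k 0<k k<p with p∣pCk k 0<k k<p
  ... | divides d pCk≡dp = begin
      ι (p C k)        ≡⟨ cong ι pCk≡dp ⟩
      ι (d ℕ.* p)      ≡⟨ ι-* d p ⟩
      ι d * ι p        ≡⟨ cong (ι d *_) ιp≡0 ⟩
      ι d * 0#         ≡⟨ zeroʳ (ι d) ⟩
      0#               ∎
    where open ≡-Reasoning

  frob : ∀ x y → (x + y) ^ p ≡ x ^ p + y ^ p
  frob = freshman p (ℕP.<-trans (s≤s z≤n) 1<p) ι-pCk≡0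

  frobⁿ : ∀ j x y → (x + y) ^ (p ℕ.^ j) ≡ x ^ (p ℕ.^ j) + y ^ (p ℕ.^ j)
  frobⁿ zero    x y = trans (*-identityʳ _) (cong₂ _+_ (sym (*-identityʳ x)) (sym (*-identityʳ y)))
  frobⁿ (suc j) x y = begin
      (x + y) ^ (p ℕ.* p ℕ.^ j)                  ≡⟨ ^-* (x + y) p (p ℕ.^ j) ⟩
      ((x + y) ^ p) ^ (p ℕ.^ j)                  ≡⟨ cong (_^ (p ℕ.^ j)) (frob x y) ⟩
      (x ^ p + y ^ p) ^ (p ℕ.^ j)                ≡⟨ frobⁿ j (x ^ p) (y ^ p) ⟩
      (x ^ p) ^ (p ℕ.^ j) + (y ^ p) ^ (p ℕ.^ j)  ≡⟨ sym (cong₂ _+_ (^-* x p (p ℕ.^ j)) (^-* y p (p ℕ.^ j))) ⟩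
      x ^ (p ℕ.* p ℕ.^ j) + y ^ (p ℕ.* p ℕ.^ j)  ∎
    where open ≡-Reasoning

lookup-injective : ∀ {A : Set} (xs : List A) → Unique xs → ∀ i j → lookup xs i ≡ lookup xs j → i ≡ j
lookup-injective (x ∷ xs) u        Fin.zero    Fin.zero    _  = refl
lookup-injective (x ∷ xs) (x∉ ∷ u) Fin.zero    (Fin.suc j) eq = ⊥-elim (All.lookup x∉ (∈-lookup j) eq)
lookup-injective (x ∷ xs) (x∉ ∷ u) (Fin.suc i) Fin.zero    eq = ⊥-elim (All.lookup x∉ (∈-lookup i) (sym eq))
lookup-injective (x ∷ xs) (x∉ ∷ u) (Fin.suc i) (Fin.suc j) eq = cong Fin.suc (lookup-injective xs u i j eq)

-- A field with N elements: its enumeration is a bijection Fin N ≅ F, which gives the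
-- pigeonhole principle and shows that ι N = 0 (translation by 1 permutes F, so
-- Σ_x x = Σ_x (x + 1) = Σ_x x + N).
module FiniteField (F : Field) (N : ℕ) (size : HasSize F N) where
  open FieldLemmas F
  import Algebra.Properties.CommutativeMonoid.Sum +-commutativeMonoid as Sum

  private
    xs = proj₁ size
    L  = length xs

    L≡N : L ≡ N
    L≡N = proj₂ (proj₂ (proj₂ size))

    elem : Fin L → Carrier
    elem = lookup xs

    index : Carrier → Fin L
    index x = Any.index (proj₁ (proj₂ size) x)

    elem-index : ∀ x → elem (index x) ≡ x
    elem-index x = sym (lookup-index (proj₁ (proj₂ size) x))

    index-elem : ∀ i → index (elem i) ≡ i
    index-elem i = lookup-injective xs (proj₁ (proj₂ (proj₂ size))) _ _ (elem-index (elem i))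

  pigeonhole-F : (h : ℕ → Carrier) → (∀ i j → i ℕ.< j → j ℕ.≤ N → h i ≢ h j) → ⊥
  pigeonhole-F h injective with pigeonhole (ℕP.n<1+n L) (λ i → index (h (toℕ i)))
  ... | i , j , i<j , same = injective (toℕ i) (toℕ j) i<j
          (subst (toℕ j ℕ.≤_) L≡N (ℕP.≤-pred (toℕ<n j)))
          (trans (sym (elem-index _)) (trans (cong elem same) (elem-index _)))

  characteristic : ι N ≡ 0#
  characteristic = subst (λ n → ι n ≡ 0#) L≡N (identityʳ-unique _ _ (sym shifted))
    where
    shift shift⁻¹ : Fin L → Fin L
    shift i    = index (elem i + 1#)
    shift⁻¹ i  = index (elem i + - 1#)
    cancel : ∀ x u v → u + v ≡ 0# → (x + u) + v ≡ x
    cancel x u v u+v≡0 = trans (+-assoc x u v) (trans (cong (x +_) u+v≡0) (+-identityʳ x))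
    shift-shift⁻¹ : ∀ i → shift (shift⁻¹ i) ≡ i
    shift-shift⁻¹ i = trans (cong (λ z → index (z + 1#)) (elem-index _))
      (trans (cong index (cancel (elem i) _ _ (-‿inverseˡ 1#))) (index-elem i))
    shift⁻¹-shift : ∀ i → shift⁻¹ (shift i) ≡ i
    shift⁻¹-shift i = trans (cong (λ z → index (z + - 1#)) (elem-index _))
      (trans (cong index (cancel (elem i) _ _ (-‿inverseʳ 1#))) (index-elem i))
    shifted : Sum.sum elem ≡ Sum.sum elem + ι L
    shifted = begin
        Sum.sum elem
          ≡⟨ Sum.sum-permute elem (permutation shift shift⁻¹ shift-shift⁻¹ shift⁻¹-shift) ⟩
        Sum.sum (λ i → elem (shift i))        ≡⟨ Sum.sum-cong-≗ (λ i → elem-index (elem i + 1#)) ⟩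
        Sum.sum (λ i → elem i + 1#)           ≡⟨ Sum.∑-distrib-+ {L} elem (λ _ → 1#) ⟩
        Sum.sum elem + Sum.sum {L} (λ _ → 1#) ≡⟨ cong (Sum.sum elem +_) (Sum.sum-replicate L {1#}) ⟩
        Sum.sum elem + ι L                    ∎
      where open ≡-Reasoning

module PrimitiveElement (F : Field) (N : ℕ) (size : HasSize F N) (ω : Field.Carrier F)
                        (prim : IsPrimitive F N ω) (1<N : 1 ℕ.< N) where
  open FieldLemmas F
  open FiniteField F N size

  N-1 = N ∸ 1

  instance
    N-1≢0 : NonZero N-1
    N-1≢0 = ℕ.>-nonZero (ℕP.m<n⇒0<n∸m 1<N)

  ω^[N-1]≡1 : ω ^ N-1 ≡ 1#
  ω^[N-1]≡1 = proj₁ prim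

  ω≢0 : ω ≢ 0#
  ω≢0 ω≡0 = 0≢1 (trans (sym (trans (cong (_^ N-1) ω≡0) (0^ N-1 (ℕP.m<n⇒0<n∸m 1<N)))) ω^[N-1]≡1)

  ω^≢0 : ∀ j → ω ^ j ≢ 0#
  ω^≢0 j = ^≢0 ω j ω≢0

  ω^-mod : ∀ t → ω ^ t ≡ ω ^ (t % N-1)
  ω^-mod t = begin
      ω ^ t                                  ≡⟨ cong (ω ^_) (m≡m%n+[m/n]*n t N-1) ⟩
      ω ^ (t % N-1 ℕ.+ (t / N-1) ℕ.* N-1)    ≡⟨ ^-+ ω (t % N-1) _ ⟩
      ω ^ (t % N-1) * ω ^ ((t / N-1) ℕ.* N-1) ≡⟨ cong (λ z → ω ^ (t % N-1) * ω ^ z) (ℕP.*-comm (t / N-1) N-1) ⟩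
      ω ^ (t % N-1) * ω ^ (N-1 ℕ.* (t / N-1)) ≡⟨ cong (ω ^ (t % N-1) *_) (^-* ω N-1 (t / N-1)) ⟩
      ω ^ (t % N-1) * (ω ^ N-1) ^ (t / N-1)   ≡⟨ cong (λ z → ω ^ (t % N-1) * z ^ (t / N-1)) ω^[N-1]≡1 ⟩
      ω ^ (t % N-1) * 1# ^ (t / N-1)          ≡⟨ cong (ω ^ (t % N-1) *_) (1^ (t / N-1)) ⟩
      ω ^ (t % N-1) * 1#                      ≡⟨ *-identityʳ _ ⟩
      ω ^ (t % N-1)                           ∎
    where open ≡-Reasoning

  order : ∀ t → ω ^ t ≡ 1# → N-1 ∣ t
  order t ω^t≡1 with t % N-1 in rem
  ... | zero  = m%n≡0⇒n∣m t N-1 rem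
  ... | suc r = ⊥-elim (proj₂ prim (suc r) (s≤s z≤n) (subst (ℕ._< N-1) rem (m%n<n t N-1))
                  (trans (sym (trans (ω^-mod t) (cong (ω ^_) rem))) ω^t≡1))

  powers-distinct : ∀ i j → i ℕ.< j → j ℕ.< N-1 → ω ^ i ≢ ω ^ j
  powers-distinct i j i<j j<N-1 ωⁱ≡ωʲ = proj₂ prim (j ∸ i) (ℕP.m<n⇒0<n∸m i<j)
      (ℕP.≤-<-trans (ℕP.m∸n≤m j i) j<N-1)
      (sym (*-cancelˡ 1# (ω ^ (j ∸ i)) (ω ^ i) (ω^≢0 i) (begin
        ω ^ i * 1#               ≡⟨ *-identityʳ _ ⟩
        ω ^ i                    ≡⟨ ωⁱ≡ωʲ ⟩
        ω ^ j                    ≡⟨ cong (ω ^_) (sym (ℕP.m+[n∸m]≡n (ℕP.<⇒≤ i<j))) ⟩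
        ω ^ (i ℕ.+ (j ∸ i))      ≡⟨ ^-+ ω i (j ∸ i) ⟩
        ω ^ i * ω ^ (j ∸ i)      ∎)))
    where open ≡-Reasoning

  search : ∀ x n → (Σ ℕ λ j → ω ^ j ≡ x) ⊎ (∀ j → j ℕ.< n → ω ^ j ≢ x)
  search x zero = inj₂ (λ j ())
  search x (suc n) with search x n
  ... | inj₁ found = inj₁ found
  ... | inj₂ absent with (ω ^ n) ≟ x
  ... | yes ωⁿ≡x = inj₁ (n , ωⁿ≡x)
  ... | no ωⁿ≢x  = inj₂ λ j j<1+n → below-or-equal j (ℕP.m<1+n⇒m<n∨m≡n j<1+n)
    where
    below-or-equal : ∀ j → j ℕ.< n ⊎ j ≡ n → ω ^ j ≢ x
    below-or-equal j (inj₁ j<n)  = absent j j<n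
    below-or-equal j (inj₂ refl) = ωⁿ≢x

  -- Every nonzero x is a power of ω: otherwise 0, x, ω^0, …, ω^(N-2) would be N + 1
  -- distinct elements.
  log : ∀ x → x ≢ 0# → Σ ℕ λ j → ω ^ j ≡ x
  log x x≢0 with search x N-1
  ... | inj₁ found  = found
  ... | inj₂ absent = ⊥-elim (pigeonhole-F seq injective)
    where
    seq : ℕ → Carrier
    seq zero          = 0#
    seq (suc zero)    = x
    seq (suc (suc j)) = ω ^ j
    bound : ∀ {j} → suc (suc j) ℕ.≤ N → j ℕ.< N-1
    bound le = ℕP.∸-monoˡ-≤ 1 le
    injective : ∀ i j → i ℕ.< j → j ℕ.≤ N → seq i ≢ seq j
    injective zero          (suc zero)    _ _ eq = x≢0 (sym eq)
    injective zero          (suc (suc j)) _ _ eq = ω^≢0 j (sym eq)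
    injective (suc zero)    (suc zero)    (s≤s ()) _ _
    injective (suc zero)    (suc (suc j)) _ le eq = absent j (bound le) (sym eq)
    injective (suc (suc i)) (suc (suc j)) (s≤s (s≤s i<j)) le eq = powers-distinct i j i<j (bound le) eq

  ^[N-1]≡1 : ∀ x → x ≢ 0# → x ^ N-1 ≡ 1#
  ^[N-1]≡1 x x≢0 with log x x≢0
  ... | (j , refl) = begin
      (ω ^ j) ^ N-1      ≡⟨ sym (^-* ω j N-1) ⟩
      ω ^ (j ℕ.* N-1)    ≡⟨ cong (ω ^_) (ℕP.*-comm j N-1) ⟩
      ω ^ (N-1 ℕ.* j)    ≡⟨ ^-* ω N-1 j ⟩
      (ω ^ N-1) ^ j      ≡⟨ cong (_^ j) ω^[N-1]≡1 ⟩
      1# ^ j             ≡⟨ 1^ j ⟩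
      1#                 ∎
    where open ≡-Reasoning

  fermat : ∀ x → x ^ N ≡ x
  fermat x with x ≟ 0#
  ... | yes refl = 0^ N (ℕP.<-trans (s≤s z≤n) 1<N)
  ... | no x≢0   = begin
      x ^ N              ≡⟨ cong (x ^_) (sym (ℕP.m+[n∸m]≡n (ℕP.<⇒≤ 1<N))) ⟩
      x ^ (1 ℕ.+ N-1)    ≡⟨ cong (x *_) (^[N-1]≡1 x x≢0) ⟩
      x * 1#             ≡⟨ *-identityʳ x ⟩
      x                  ∎
    where open ≡-Reasoning

module NonzeroCount (F : Field) where
  open FieldLemmas F

  isNonzero : Carrier → ℕ
  isNonzero x with x ≟ 0#
  ... | yes _ = 0
  ... | no _  = 1

  count : ℕ → (ℕ → Carrier) → ℕ
  count zero    f = 0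
  count (suc n) f = isNonzero (f 0) ℕ.+ count n (λ m → f (suc m))

  weight≡count : ∀ n f → weight F n (λ i → f (toℕ i)) ≡ count n f
  weight≡count zero    f = refl
  weight≡count (suc n) f with f 0 ≟ 0#
  ... | yes _ = weight≡count n (λ m → f (suc m))
  ... | no _  = cong suc (weight≡count n (λ m → f (suc m)))

  weight≡0⇒zero : ∀ n c → weight F n c ≡ 0 → IsZeroWord F c
  weight≡0⇒zero (suc n) c wt≡0 with c Fin.zero ≟ 0#
  weight≡0⇒zero (suc n) c wt≡0 | yes c₀≡0 = λ
    { Fin.zero → c₀≡0 ; (Fin.suc i) → weight≡0⇒zero n (λ i → c (Fin.suc i)) wt≡0 i }
  weight≡0⇒zero (suc n) c ()   | no _

  zero⇒weight≡0 : ∀ n c → IsZeroWord F c → weight F n c ≡ 0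
  zero⇒weight≡0 zero    c _     = refl
  zero⇒weight≡0 (suc n) c c≡0 with c Fin.zero ≟ 0#
  ... | yes _   = zero⇒weight≡0 n (λ i → c (Fin.suc i)) (λ i → c≡0 (Fin.suc i))
  ... | no c₀≢0 = ⊥-elim (c₀≢0 (c≡0 Fin.zero))

  isNonzero0 : isNonzero 0# ≡ 0
  isNonzero0 with 0# ≟ 0#
  ... | yes _   = refl
  ... | no 0≢0  = ⊥-elim (0≢0 refl)

  count-cong : ∀ n f g → (∀ m → f m ≡ g m) → count n f ≡ count n g
  count-cong zero    f g f≗g = refl
  count-cong (suc n) f g f≗g = cong₂ ℕ._+_ (cong isNonzero (f≗g 0)) (count-cong n _ _ (λ m → f≗g (suc m)))

  count-zero : ∀ n f → (∀ m → f m ≡ 0#) → count n f ≡ 0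
  count-zero zero    f f≡0 = refl
  count-zero (suc n) f f≡0 =
    cong₂ ℕ._+_ (trans (cong isNonzero (f≡0 0)) isNonzero0) (count-zero n _ (λ m → f≡0 (suc m)))

  count≡0⇒zero : ∀ n f → count n f ≡ 0 → ∀ m → m ℕ.< n → f m ≡ 0#
  count≡0⇒zero (suc n) f count≡0 m m<n with f 0 ≟ 0#
  count≡0⇒zero (suc n) f count≡0 zero    m<n | yes f₀≡0 = f₀≡0
  count≡0⇒zero (suc n) f count≡0 (suc m) m<n | yes _    =
    count≡0⇒zero n (λ m → f (suc m)) count≡0 m (ℕP.≤-pred m<n)
  count≡0⇒zero (suc n) f () m m<n | no _

  count-interleave : ∀ M f →
    count (double M) f ≡ count M (λ m → f (double m)) ℕ.+ count M (λ m → f (suc (double m)))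
  count-interleave zero    f = refl
  count-interleave (suc M) f =
    trans (cong (λ z → isNonzero (f 0) ℕ.+ (isNonzero (f 1) ℕ.+ z)) (count-interleave M (λ m → f (suc (suc m)))))
          (interchange (isNonzero (f 0)) (isNonzero (f 1)) _ _)
    where
    interchange : ∀ a b c d → a ℕ.+ (b ℕ.+ (c ℕ.+ d)) ≡ (a ℕ.+ c) ℕ.+ (b ℕ.+ d)
    interchange = solve-∀

  count-snoc : ∀ n f → count (suc n) f ≡ count n f ℕ.+ isNonzero (f n)
  count-snoc zero    f = ℕP.+-identityʳ _
  count-snoc (suc n) f = trans (cong (isNonzero (f 0) ℕ.+_) (count-snoc n (λ m → f (suc m))))
    (sym (ℕP.+-assoc (isNonzero (f 0)) _ _))

  count-rotate : ∀ M h → h M ≡ h 0 → count M (λ m → h (suc m)) ≡ count M h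
  count-rotate M h periodic = ℕP.+-cancelˡ-≡ (isNonzero (h 0)) _ _
    (trans (count-snoc M h) (trans (cong (count M h ℕ.+_) (cong isNonzero periodic)) (ℕP.+-comm (count M h) _)))

  count-shift : ∀ M h → (∀ m → h (M ℕ.+ m) ≡ h m) → ∀ r → count M (λ m → h (r ℕ.+ m)) ≡ count M h
  count-shift M h periodic zero    = refl
  count-shift M h periodic (suc r) = begin
      count M (λ m → h (suc r ℕ.+ m))     ≡⟨ count-cong M _ _ (λ m → cong h (sym (ℕP.+-suc r m))) ⟩
      count M (λ m → h (r ℕ.+ suc m))     ≡⟨ count-rotate M (λ m → h (r ℕ.+ m)) wraps ⟩
      count M (λ m → h (r ℕ.+ m))         ≡⟨ count-shift M h periodic r ⟩
      count M h                           ∎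
    where
    open ≡-Reasoning
    wraps : h (r ℕ.+ M) ≡ h (r ℕ.+ 0)
    wraps = trans (cong h (ℕP.+-comm r M)) (trans (periodic r) (cong h (sym (ℕP.+-identityʳ r))))

  twoWeight-intro : ∀ n (cw : Carrier → Fin n → Carrier) c → c ≢ 0 →
    (∀ γ → weight F n (cw γ) ≡ 0 ⊎ weight F n (cw γ) ≡ c ⊎ weight F n (cw γ) ≡ c ℕ.+ c) →
    ∀ γ₁ γ₂ → weight F n (cw γ₁) ≡ c → weight F n (cw γ₂) ≡ c ℕ.+ c → IsTwoWeight F n cw
  twoWeight-intro n cw c c≢0 weights γ₁ γ₂ wt₁ wt₂ =
    c , c ℕ.+ c , c≢2c , classify , (γ₁ , nonzero γ₁ wt₁ c≢0 , wt₁) , (γ₂ , nonzero γ₂ wt₂ 2c≢0 , wt₂)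
    where
    c≢2c : c ≢ c ℕ.+ c
    c≢2c c≡2c = c≢0 (ℕP.+-cancelˡ-≡ c c 0 (trans (sym c≡2c) (sym (ℕP.+-identityʳ c))))
    2c≢0 : c ℕ.+ c ≢ 0
    2c≢0 2c≡0 = c≢0 (ℕP.m+n≡0⇒m≡0 c 2c≡0)
    nonzero : ∀ γ {w} → weight F n (cw γ) ≡ w → w ≢ 0 → ¬ IsZeroWord F (cw γ)
    nonzero γ wt w≢0 zero-word = w≢0 (trans (sym wt) (zero⇒weight≡0 n _ zero-word))
    classify : ∀ γ → ¬ IsZeroWord F (cw γ) → weight F n (cw γ) ≡ c ⊎ weight F n (cw γ) ≡ c ℕ.+ c
    classify γ nonzero-word with weights γ
    ... | inj₁ wt≡0        = ⊥-elim (nonzero-word (weight≡0⇒zero n _ wt≡0))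
    ... | inj₂ c-or-2c     = c-or-2c

module Sums (F : Field) where
  open FieldLemmas F

  Σ< : ℕ → (ℕ → Carrier) → Carrier
  Σ< = sumTo F

  sum-cong : ∀ n f g → (∀ j → f j ≡ g j) → Σ< n f ≡ Σ< n g
  sum-cong zero    f g f≗g = refl
  sum-cong (suc n) f g f≗g = cong₂ _+_ (sum-cong n f g f≗g) (f≗g n)

  sum-+ : ∀ m n f → Σ< (m ℕ.+ n) f ≡ Σ< m f + Σ< n (λ j → f (m ℕ.+ j))
  sum-+ m zero    f = trans (cong (λ k → Σ< k f) (ℕP.+-identityʳ m)) (sym (+-identityʳ _))
  sum-+ m (suc n) f = begin
      Σ< (m ℕ.+ suc n) f                                   ≡⟨ cong (λ k → Σ< k f) (ℕP.+-suc m n) ⟩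
      Σ< (m ℕ.+ n) f + f (m ℕ.+ n)                         ≡⟨ cong (_+ f (m ℕ.+ n)) (sum-+ m n f) ⟩
      (Σ< m f + Σ< n (λ j → f (m ℕ.+ j))) + f (m ℕ.+ n)    ≡⟨ +-assoc _ _ _ ⟩
      Σ< m f + (Σ< n (λ j → f (m ℕ.+ j)) + f (m ℕ.+ n))    ∎
    where open ≡-Reasoning

  sum-distrib-+ : ∀ n f g → Σ< n (λ j → f j + g j) ≡ Σ< n f + Σ< n g
  sum-distrib-+ zero    f g = sym (+-identityʳ 0#)
  sum-distrib-+ (suc n) f g = trans (cong (_+ (f n + g n)) (sum-distrib-+ n f g))
    (solve 4 (λ a b c d → (a :+ b) :+ (c :+ d) := (a :+ c) :+ (b :+ d)) refl (Σ< n f) (Σ< n g) (f n) (g n))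

  sum-front : ∀ n f → Σ< (suc n) f ≡ f 0 + Σ< n (λ j → f (suc j))
  sum-front zero    f = trans (+-identityˡ _) (sym (+-identityʳ _))
  sum-front (suc n) f = trans (cong (_+ f (suc n)) (sum-front n f)) (+-assoc _ _ _)

  sum-*ˡ : ∀ x n f → x * Σ< n f ≡ Σ< n (λ j → x * f j)
  sum-*ˡ x zero    f = zeroʳ x
  sum-*ˡ x (suc n) f = trans (distribˡ x _ _) (cong (_+ x * f n) (sum-*ˡ x n f))

  sum-zero : ∀ n f → (∀ j → j ℕ.< n → f j ≡ 0#) → Σ< n f ≡ 0#
  sum-zero zero    f f≡0 = refl
  sum-zero (suc n) f f≡0 =
    trans (cong₂ _+_ (sum-zero n f (λ j j<n → f≡0 j (ℕP.m<n⇒m<1+n j<n))) (f≡0 n (ℕP.n<1+n n))) (+-identityʳ 0#)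

  sum-swap : ∀ m n (G : ℕ → ℕ → Carrier) →
             Σ< m (λ i → Σ< n (λ j → G i j)) ≡ Σ< n (λ j → Σ< m (λ i → G i j))
  sum-swap zero    n G = sym (sum-zero n _ (λ _ _ → refl))
  sum-swap (suc m) n G = trans (cong (_+ Σ< n (λ j → G m j)) (sum-swap m n G))
    (sym (sum-distrib-+ n (λ j → Σ< m (λ i → G i j)) (λ j → G m j)))

  sum-first : ∀ b f → 0 ℕ.< b → (∀ j → 0 ℕ.< j → j ℕ.< b → f j ≡ 0#) → Σ< b f ≡ f 0
  sum-first (suc b) f _ rest≡0 = trans (sum-front b f)
    (trans (cong (f 0 +_) (sum-zero b _ (λ j j<b → rest≡0 (suc j) (s≤s z≤n) (s≤s j<b)))) (+-identityʳ _))

  sum-const-1 : ∀ n → Σ< n (λ _ → 1#) ≡ ι n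
  sum-const-1 zero    = refl
  sum-const-1 (suc n) = trans (cong (_+ 1#) (sum-const-1 n)) (+-comm _ _)

  geometric-telescope : ∀ θ n → θ * Σ< n (θ ^_) + 1# ≡ Σ< n (θ ^_) + θ ^ n
  geometric-telescope θ zero    = trans (cong (_+ 1#) (zeroʳ θ)) (trans (+-identityˡ 1#) (sym (+-identityˡ 1#)))
  geometric-telescope θ (suc n) = begin
      θ * (S + θ ^ n) + 1#
        ≡⟨ solve 3 (λ t s u → t :* (s :+ u) :+ con 1 := (t :* s :+ con 1) :+ t :* u) refl θ S (θ ^ n) ⟩
      (θ * S + 1#) + θ * θ ^ n     ≡⟨ cong (_+ θ * θ ^ n) (geometric-telescope θ n) ⟩
      (S + θ ^ n) + θ * θ ^ n      ∎
    where
    open ≡-Reasoning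
    S = Σ< n (θ ^_)

  geometric : ∀ θ n → θ ≢ 1# → θ ^ n ≡ 1# → Σ< n (θ ^_) ≡ 0#
  geometric θ n θ≢1 θⁿ≡1 with Σ< n (θ ^_) ≟ 0#
  ... | yes S≡0 = S≡0
  ... | no S≢0  = ⊥-elim (θ≢1 (*-cancelʳ θ 1# S S≢0 (trans θS≡S (sym (*-identityˡ S)))))
    where
    S = Σ< n (θ ^_)
    θS≡S : θ * S ≡ S
    θS≡S = ∙-cancelʳ 1# _ _ (trans (geometric-telescope θ n) (cong (S +_) θⁿ≡1))

module Corollary (p a : ℕ) (pp : Prime p) (p≢2 : p ≢ 2) (0<a : 0 ℕ.< a)
    (F : Field) (size : HasSize F ((p ℕ.^ a) ℕ.^ 2))
    (ω : Field.Carrier F) (prim : IsPrimitive F ((p ℕ.^ a) ℕ.^ 2) ω)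
    (k n : ℕ) (2k≡q+1 : 2 ℕ.* k ≡ p ℕ.^ a ℕ.+ 1) (kn≡Q-1 : k ℕ.* n ≡ (p ℕ.^ a) ℕ.^ 2 ∸ 1) where

  open FieldLemmas F
  open PrimeBinomial p pp using (1<p)
  open NonzeroCount F
  open Sums F
  open ≡-Reasoning

  q = p ℕ.^ a
  Q = q ℕ.^ 2
  M = q ∸ 1

  2<q : 2 ℕ.< q
  2<q = ℕP.<-≤-trans 2<p (m≤m^n p a (ℕP.<-trans (s≤s z≤n) 1<p) 0<a)
    where
    2<p : 2 ℕ.< p
    2<p with ℕP.m≤n⇒m<n∨m≡n 1<p
    ... | inj₁ 2<p = 2<p
    ... | inj₂ 2≡p = ⊥-elim (p≢2 (sym 2≡p))

  q≡1+M : q ≡ suc M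
  q≡1+M = sym (ℕP.m+[n∸m]≡n {1} {q} (ℕP.≤-trans (s≤s z≤n) (ℕP.<⇒≤ 2<q)))

  1<M : 1 ℕ.< M
  1<M = ℕP.≤-pred (subst (2 ℕ.<_) q≡1+M 2<q)

  instance
    p≢0 : NonZero p
    p≢0 = prime⇒nonZero pp
    M≢0 : NonZero M
    M≢0 = ℕ.>-nonZero (ℕP.<-trans (s≤s z≤n) 1<M)
    q+1≢0 : NonZero (q ℕ.+ 1)
    q+1≢0 = ℕ.≢-nonZero (λ q+1≡0 → ℕP.<⇒≢ (s≤s z≤n) (sym (trans (ℕP.+-comm 1 q) q+1≡0)))

  Q≡ : Q ≡ suc ((q ℕ.+ 1) ℕ.* M)
  Q≡ rewrite q≡1+M = expand M
    where
    expand : ∀ M → suc M ℕ.* (suc M ℕ.* 1) ≡ suc ((suc M ℕ.+ 1) ℕ.* M)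
    expand = solve-∀

  Q-1≡ : Q ∸ 1 ≡ (q ℕ.+ 1) ℕ.* M
  Q-1≡ = cong (_∸ 1) Q≡

  1<Q : 1 ℕ.< Q
  1<Q = subst (1 ℕ.<_) (sym Q≡) (s≤s (ℕ.>-nonZero⁻¹ _ {{ℕP.m*n≢0 (q ℕ.+ 1) M}}))

  k≢0 : k ≢ 0
  k≢0 refl = ℕP.<⇒≢ (ℕP.<-trans (s≤s z≤n) (ℕP.≤-trans (ℕP.<⇒≤ 2<q) (ℕP.m≤m+n q 1))) 2k≡q+1

  instance
    k-nonZero : NonZero k
    k-nonZero = ℕ.≢-nonZero k≢0

  k*double : ∀ m → k ℕ.* double m ≡ (q ℕ.+ 1) ℕ.* m
  k*double m = trans (cong (k ℕ.*_) (double≡ m)) (trans (regroup k m) (cong (ℕ._* m) 2k≡q+1))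
    where
    regroup : ∀ k m → k ℕ.* (m ℕ.+ m) ≡ (2 ℕ.* k) ℕ.* m
    regroup = solve-∀

  n≡2M : n ≡ double M
  n≡2M = ℕP.*-cancelˡ-≡ n (double M) k (trans kn≡Q-1 (trans Q-1≡ (sym (k*double M))))

  open FiniteField F Q size using (characteristic)
  open PrimitiveElement F Q size ω prim 1<Q using (ω^[N-1]≡1; ω^≢0; order; log; fermat)

  ιp≡0 : ι p ≡ 0#
  ιp≡0 = ^≡0 (ι p) (a ℕ.* 2) (begin
      ι p ^ (a ℕ.* 2)       ≡⟨ sym (ι-^ p (a ℕ.* 2)) ⟩
      ι (p ℕ.^ (a ℕ.* 2))   ≡⟨ cong ι (sym (ℕP.^-*-assoc p a 2)) ⟩
      ι Q                   ≡⟨ characteristic ⟩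
      0#                    ∎)

  open Frobenius F p pp ιp≡0 using (frobⁿ)

  frob-q : ∀ x y → (x + y) ^ q ≡ x ^ q + y ^ q
  frob-q = frobⁿ a

  ιM≢0 : ι M ≢ 0#
  ιM≢0 = ι-consecutive M (subst (λ m → ι m ≡ 0#) q≡1+M ιq≡0)
    where
    ιq≡0 : ι q ≡ 0#
    ιq≡0 = trans (ι-^ p a) (trans (cong (_^ a) ιp≡0) (0^ a 0<a))

  2≢0 : 1# + 1# ≢ 0#
  2≢0 2≡0 with oddPrime pp p≢2
  ... | t , p≡1+2t = ι-consecutive (t ℕ.* 2) (subst (λ m → ι m ≡ 0#) p≡1+2t ιp≡0)
          (trans (ι-* t 2) (trans (cong (ι t *_) ι2≡0) (zeroʳ _)))
    where
    ι2≡0 : ι 2 ≡ 0#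
    ι2≡0 = trans (cong (1# +_) (+-identityʳ 1#)) 2≡0

  -- g m = ω^((q+1)m). The sequence g is M-periodic and multiplicative, and its values
  -- are exactly the nonzero elements fixed by x ↦ x^q (the multiplicative group of F_q).

  g : ℕ → Carrier
  g m = ω ^ ((q ℕ.+ 1) ℕ.* m)

  gM≡1 : g M ≡ 1#
  gM≡1 = subst (λ z → ω ^ z ≡ 1#) Q-1≡ ω^[N-1]≡1

  g-+ : ∀ r m → g r * g m ≡ g (r ℕ.+ m)
  g-+ r m = trans (sym (^-+ ω ((q ℕ.+ 1) ℕ.* r) _)) (cong (ω ^_) (sym (ℕP.*-distribˡ-+ (q ℕ.+ 1) r m)))

  g-periodic : ∀ m → g (M ℕ.+ m) ≡ g m
  g-periodic m = begin
      g (M ℕ.+ m)     ≡⟨ sym (g-+ M m) ⟩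
      g M * g m       ≡⟨ cong (_* g m) gM≡1 ⟩
      1# * g m        ≡⟨ *-identityˡ _ ⟩
      g m             ∎

  g-swap : ∀ m e → g m ^ e ≡ g e ^ m
  g-swap m e = begin
      g m ^ e                            ≡⟨ sym (^-* ω ((q ℕ.+ 1) ℕ.* m) e) ⟩
      ω ^ (((q ℕ.+ 1) ℕ.* m) ℕ.* e)      ≡⟨ cong (ω ^_) (rearrange (q ℕ.+ 1) m e) ⟩
      ω ^ (((q ℕ.+ 1) ℕ.* e) ℕ.* m)      ≡⟨ ^-* ω ((q ℕ.+ 1) ℕ.* e) m ⟩
      g e ^ m                            ∎
    where
    rearrange : ∀ x m e → (x ℕ.* m) ℕ.* e ≡ (x ℕ.* e) ℕ.* m
    rearrange = solve-∀

  g^M≡1 : ∀ m → g m ^ M ≡ 1#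
  g^M≡1 m = trans (g-swap m M) (trans (cong (_^ m) gM≡1) (1^ m))

  ^q : ∀ x → x ^ q ≡ x * x ^ M
  ^q x = cong (x ^_) q≡1+M

  g^q≡g : ∀ m → g m ^ q ≡ g m
  g^q≡g m = trans (^q (g m)) (trans (cong (g m *_) (g^M≡1 m)) (*-identityʳ _))

  fixed⇒g : ∀ u → u ^ q ≡ u → u ≢ 0# → Σ ℕ λ r → u ≡ g r
  fixed⇒g u u^q≡u u≢0 with log u u≢0
  ... | (j , ωʲ≡u) = r , trans (sym ωʲ≡u) (cong (ω ^_) (trans (_∣_.equality q+1∣j) (ℕP.*-comm r (q ℕ.+ 1))))
    where
    u^M≡1 : u ^ M ≡ 1#
    u^M≡1 = *-cancelˡ (u ^ M) 1# u u≢0 (trans (sym (^q u)) (trans u^q≡u (sym (*-identityʳ u))))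
    ω^[jM]≡1 : ω ^ (j ℕ.* M) ≡ 1#
    ω^[jM]≡1 = trans (^-* ω j M) (trans (cong (_^ M) ωʲ≡u) u^M≡1)
    q+1∣j : (q ℕ.+ 1) ∣ j
    q+1∣j = *-cancelʳ-∣ M (subst (_∣ j ℕ.* M) Q-1≡ (order (j ℕ.* M) ω^[jM]≡1))
    r = _∣_.quotient q+1∣j

  -- ζ = ω^k and h = ζ^(q-1). Since h² = ω^((q+1)(q-1)) = 1 but h ≠ 1, h = -1: ζ^q = -ζ.

  ζ h : Carrier
  ζ = ω ^ k
  h = ζ ^ M

  h*h≡1 : h * h ≡ 1#
  h*h≡1 = begin
      h * h                   ≡⟨ sym (^-+ ζ M M) ⟩
      ζ ^ (M ℕ.+ M)           ≡⟨ sym (^-* ω k (M ℕ.+ M)) ⟩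
      ω ^ (k ℕ.* (M ℕ.+ M))   ≡⟨ cong (ω ^_) (trans (cong (k ℕ.*_) (sym (double≡ M))) (k*double M)) ⟩
      g M                     ≡⟨ gM≡1 ⟩
      1#                      ∎

  h≢1 : h ≢ 1#
  h≢1 h≡1 = proj₂ prim (k ℕ.* M) (ℕ.>-nonZero⁻¹ _ {{ℕP.m*n≢0 k M}}) kM<Q-1 (trans (^-* ω k M) h≡1)
    where
    kM<Q-1 : k ℕ.* M ℕ.< Q ∸ 1
    kM<Q-1 = subst (k ℕ.* M ℕ.<_) (sym (trans Q-1≡ (sym (k*double M))))
               (ℕP.*-monoʳ-< k (subst (M ℕ.<_) (sym (double≡ M)) (ℕP.m<m+n M (ℕP.<-trans (s≤s z≤n) 1<M))))

  1+h≡0 : 1# + h ≡ 0#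
  1+h≡0 with (1# + h) ≟ 0#
  ... | yes 1+h≡0 = 1+h≡0
  ... | no 1+h≢0  = ⊥-elim (h≢1 (*-cancelˡ h 1# (1# + h) 1+h≢0 (begin
      (1# + h) * h        ≡⟨ solve 1 (λ h → (con 1 :+ h) :* h := h :+ h :* h) refl h ⟩
      h + h * h           ≡⟨ cong (h +_) h*h≡1 ⟩
      h + 1#              ≡⟨ +-comm h 1# ⟩
      1# + h              ≡⟨ sym (*-identityʳ _) ⟩
      (1# + h) * 1#       ∎)))

  ζ+ζh≡0 : ζ + ζ * h ≡ 0#
  ζ+ζh≡0 = trans (solve 2 (λ z h → z :+ z :* h := z :* (con 1 :+ h)) refl ζ h)
                 (trans (cong (ζ *_) 1+h≡0) (zeroʳ ζ))

  -- The relative trace U y = y + y^q takes values in F_q, and since g m ∈ F_q the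
  -- absolute trace factors: Tr_{q²/p}(y g m) = Tr_{q/p}(U(y) g m).

  trace-q : Carrier → Carrier
  trace-q z = Σ< a (λ j → z ^ (p ℕ.^ j))

  U : Carrier → Carrier
  U y = y + y ^ q

  U-fixed : ∀ y → U y ^ q ≡ U y
  U-fixed y = begin
      (y + y ^ q) ^ q         ≡⟨ frob-q y (y ^ q) ⟩
      y ^ q + (y ^ q) ^ q     ≡⟨ cong (y ^ q +_) (sym (^-* y q q)) ⟩
      y ^ q + y ^ (q ℕ.* q)   ≡⟨ cong (λ z → y ^ q + y ^ (q ℕ.* z)) (sym (ℕP.*-identityʳ q)) ⟩
      y ^ q + y ^ Q           ≡⟨ cong (y ^ q +_) (fermat y) ⟩
      y ^ q + y               ≡⟨ +-comm _ _ ⟩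
      y + y ^ q               ∎

  trace-reduction : ∀ y m → trace F p (2 ℕ.* a) (y * g m) ≡ trace-q (U y * g m)
  trace-reduction y m = begin
      Σ< (2 ℕ.* a) f                          ≡⟨ cong (λ z → Σ< (a ℕ.+ z) f) (ℕP.+-identityʳ a) ⟩
      Σ< (a ℕ.+ a) f                          ≡⟨ sum-+ a a f ⟩
      Σ< a f + Σ< a (λ j → f (a ℕ.+ j))       ≡⟨ cong (Σ< a f +_) (sum-cong a _ _ upper-half) ⟩
      Σ< a f + Σ< a f′                        ≡⟨ sym (sum-distrib-+ a f f′) ⟩
      Σ< a (λ j → f j + f′ j)                 ≡⟨ sum-cong a _ _ (λ j → sym (frobⁿ j (y * g m) (y ^ q * g m))) ⟩
      Σ< a (λ j → (y * g m + y ^ q * g m) ^ (p ℕ.^ j))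
        ≡⟨ sum-cong a _ _ (λ j → cong (_^ (p ℕ.^ j)) (sym (distribʳ (g m) y (y ^ q)))) ⟩
      trace-q (U y * g m)                     ∎
    where
    f f′ : ℕ → Carrier
    f j  = (y * g m) ^ (p ℕ.^ j)
    f′ j = (y ^ q * g m) ^ (p ℕ.^ j)
    upper-half : ∀ j → f (a ℕ.+ j) ≡ f′ j
    upper-half j = begin
        (y * g m) ^ (p ℕ.^ (a ℕ.+ j))    ≡⟨ cong ((y * g m) ^_) (ℕP.^-distribˡ-+-* p a j) ⟩
        (y * g m) ^ (q ℕ.* p ℕ.^ j)      ≡⟨ ^-* (y * g m) q (p ℕ.^ j) ⟩
        ((y * g m) ^ q) ^ (p ℕ.^ j)      ≡⟨ cong (_^ (p ℕ.^ j)) (trans (*-^ y (g m) q) (cong (y ^ q *_) (g^q≡g m))) ⟩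
        f′ j                             ∎

  B : Carrier → ℕ
  B u = count M (λ m → trace-q (u * g m))

  c : ℕ
  c = B 1#

  cw : Carrier → Fin n → Carrier
  cw = codeword F p (2 ℕ.* a) ω k n

  weight-decomposition : ∀ γ → weight F n (cw γ) ≡ B (U γ) ℕ.+ B (U (γ * ζ))
  weight-decomposition γ = begin
      weight F n (cw γ)          ≡⟨ weight≡count n entry ⟩
      count n entry              ≡⟨ cong (λ z → count z entry) n≡2M ⟩
      count (double M) entry     ≡⟨ count-interleave M entry ⟩
      count M (λ m → entry (double m)) ℕ.+ count M (λ m → entry (suc (double m)))
        ≡⟨ cong₂ ℕ._+_ (count-cong M _ _ even) (count-cong M _ _ odd) ⟩
      B (U γ) ℕ.+ B (U (γ * ζ))  ∎
    where
    entry : ℕ → Carrier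
    entry i = trace F p (2 ℕ.* a) (γ * ω ^ (k ℕ.* i))
    even : ∀ m → entry (double m) ≡ trace-q (U γ * g m)
    even m = trans (cong (λ z → trace F p (2 ℕ.* a) (γ * ω ^ z)) (k*double m)) (trace-reduction γ m)
    odd : ∀ m → entry (suc (double m)) ≡ trace-q (U (γ * ζ) * g m)
    odd m = trans (cong (trace F p (2 ℕ.* a)) (begin
        γ * ω ^ (k ℕ.* suc (double m))   ≡⟨ cong (λ z → γ * ω ^ z) (ℕP.*-suc k (double m)) ⟩
        γ * ω ^ (k ℕ.+ k ℕ.* double m)   ≡⟨ cong (γ *_) (^-+ ω k (k ℕ.* double m)) ⟩
        γ * (ζ * ω ^ (k ℕ.* double m))   ≡⟨ cong (λ z → γ * (ζ * ω ^ z)) (k*double m) ⟩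
        γ * (ζ * g m)                    ≡⟨ sym (*-assoc γ ζ (g m)) ⟩
        (γ * ζ) * g m                    ∎)) (trace-reduction (γ * ζ) m)

  B-zero : B 0# ≡ 0
  B-zero = count-zero M _ (λ m → trans (cong trace-q (zeroˡ (g m)))
             (sum-zero a _ (λ j _ → 0^ (p ℕ.^ j) (ℕP.m^n>0 p j))))

  B-const : ∀ u → u ^ q ≡ u → u ≢ 0# → B u ≡ c
  B-const u u^q≡u u≢0 with fixed⇒g u u^q≡u u≢0
  ... | (r , u≡gr) = begin
      count M (λ m → trace-q (u * g m))
        ≡⟨ count-cong M _ _ (λ m → cong trace-q (trans (cong (_* g m) u≡gr) (g-+ r m))) ⟩
      count M (λ m → trace-q (g (r ℕ.+ m)))
        ≡⟨ count-shift M (λ m → trace-q (g m)) (λ m → cong trace-q (g-periodic m)) r ⟩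
      count M (λ m → trace-q (g m))
        ≡⟨ count-cong M _ _ (λ m → cong trace-q (sym (*-identityˡ (g m)))) ⟩
      c                                       ∎

  B∘U-values : ∀ y → B (U y) ≡ 0 ⊎ B (U y) ≡ c
  B∘U-values y with U y ≟ 0#
  ... | yes Uy≡0 = inj₁ (trans (cong B Uy≡0) B-zero)
  ... | no Uy≢0  = inj₂ (B-const (U y) (U-fixed y) Uy≢0)

  weights : ∀ γ → weight F n (cw γ) ≡ 0 ⊎ weight F n (cw γ) ≡ c ⊎ weight F n (cw γ) ≡ c ℕ.+ c
  weights γ with B∘U-values γ | B∘U-values (γ * ζ)
  ... | inj₁ b₁≡0 | inj₁ b₂≡0 = inj₁ (trans (weight-decomposition γ) (cong₂ ℕ._+_ b₁≡0 b₂≡0))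
  ... | inj₁ b₁≡0 | inj₂ b₂≡c = inj₂ (inj₁ (trans (weight-decomposition γ) (cong₂ ℕ._+_ b₁≡0 b₂≡c)))
  ... | inj₂ b₁≡c | inj₁ b₂≡0 = inj₂ (inj₁ (trans (weight-decomposition γ)
                                  (trans (cong₂ ℕ._+_ b₁≡c b₂≡0) (ℕP.+-identityʳ c))))
  ... | inj₂ b₁≡c | inj₂ b₂≡c = inj₂ (inj₂ (trans (weight-decomposition γ) (cong₂ ℕ._+_ b₁≡c b₂≡c)))

  -- c ≠ 0, since Σ_{m<M} g m^(q-2) Tr_{q/p}(g m) = M ≠ 0 in F. Expanding the trace, this
  -- is Σ_{j<a} Σ_{m<M} g m^(q-2+p^j); the term j = 0 is Σ_m g m^(q-1) = M, and for j > 0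
  -- the inner sum is a geometric sum of θ = g (q-2+p^j) ≠ 1, hence 0.

  exponent : ℕ → ℕ
  exponent j = (q ∸ 2) ℕ.+ p ℕ.^ j

  inner-sum-0 : Σ< M (λ m → g m ^ exponent 0) ≡ ι M
  inner-sum-0 = trans (sum-cong M _ _ (λ m → trans (cong (g m ^_) exponent0≡M) (g^M≡1 m))) (sum-const-1 M)
    where
    exponent0≡M : exponent 0 ≡ M
    exponent0≡M = trans (cong (λ z → (z ∸ 2) ℕ.+ 1) q≡1+M) (ℕP.m∸n+n≡m {M} {1} (ℕP.<⇒≤ 1<M))

  g-exponent≢1 : ∀ j → 0 ℕ.< j → j ℕ.< a → g (exponent j) ≢ 1#
  g-exponent≢1 j 0<j j<a g≡1 = ∤-pred+ M (p ℕ.^ j) 1<pʲ pʲ≤M M∣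
    where
    1<pʲ : 1 ℕ.< p ℕ.^ j
    1<pʲ = ℕP.<-≤-trans 1<p (m≤m^n p j (ℕP.<-trans (s≤s z≤n) 1<p) 0<j)
    pʲ≤M : p ℕ.^ j ℕ.≤ M
    pʲ≤M = ℕP.≤-pred (subst (p ℕ.^ j ℕ.<_) q≡1+M (ℕP.^-monoʳ-< p 1<p j<a))
    M∣ : M ∣ (M ∸ 1) ℕ.+ p ℕ.^ j
    M∣ = subst (λ z → M ∣ (z ∸ 2) ℕ.+ p ℕ.^ j) q≡1+M
           (*-cancelˡ-∣ (q ℕ.+ 1) (subst (_∣ (q ℕ.+ 1) ℕ.* exponent j) Q-1≡ (order _ g≡1)))

  inner-sum-rest : ∀ j → 0 ℕ.< j → j ℕ.< a → Σ< M (λ m → g m ^ exponent j) ≡ 0#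
  inner-sum-rest j 0<j j<a =
    trans (sum-cong M _ _ (λ m → g-swap m (exponent j)))
          (geometric (g (exponent j)) M (g-exponent≢1 j 0<j j<a) (g^M≡1 (exponent j)))

  weighted-trace-sum : Σ< M (λ m → g m ^ (q ∸ 2) * trace-q (g m)) ≡ ι M
  weighted-trace-sum = begin
      Σ< M (λ m → g m ^ (q ∸ 2) * trace-q (g m))
        ≡⟨ sum-cong M _ _ (λ m → trans (sum-*ˡ (g m ^ (q ∸ 2)) a _)
              (sum-cong a _ _ (λ j → sym (^-+ (g m) (q ∸ 2) (p ℕ.^ j))))) ⟩
      Σ< M (λ m → Σ< a (λ j → g m ^ exponent j))   ≡⟨ sum-swap M a (λ m j → g m ^ exponent j) ⟩
      Σ< a (λ j → Σ< M (λ m → g m ^ exponent j))   ≡⟨ sum-first a _ 0<a inner-sum-rest ⟩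
      Σ< M (λ m → g m ^ exponent 0)                ≡⟨ inner-sum-0 ⟩
      ι M                                          ∎

  c≢0 : c ≢ 0
  c≢0 c≡0 = ιM≢0 (trans (sym weighted-trace-sum) (sum-zero M _ (λ m m<M →
    trans (cong (g m ^ (q ∸ 2) *_) (trans (cong trace-q (sym (*-identityˡ (g m))))
                                          (count≡0⇒zero M _ c≡0 m m<M)))
          (zeroʳ _))))

  -- Witnesses: γ = 1 has U 1 = 2 ≠ 0 and U ζ = 0, so weight c; γ₂ = 1 + ζ has
  -- U γ₂ = 2 and U (γ₂ ζ) = 2ζ², both nonzero, so weight 2c.

  ζ^q : ζ ^ q ≡ ζ * h
  ζ^q = ^q ζ

  weight-1 : weight F n (cw 1#) ≡ c
  weight-1 = begin
      weight F n (cw 1#)              ≡⟨ weight-decomposition 1# ⟩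
      B (U 1#) ℕ.+ B (U (1# * ζ))
        ≡⟨ cong₂ ℕ._+_ (B-const _ (U-fixed 1#) U1≢0) (trans (cong B Uζ≡0) B-zero) ⟩
      c ℕ.+ 0                         ≡⟨ ℕP.+-identityʳ c ⟩
      c                               ∎
    where
    U1≢0 : U 1# ≢ 0#
    U1≢0 U1≡0 = 2≢0 (trans (sym (cong (1# +_) (1^ q))) U1≡0)
    Uζ≡0 : U (1# * ζ) ≡ 0#
    Uζ≡0 = trans (cong U (*-identityˡ ζ)) (trans (cong (ζ +_) ζ^q) ζ+ζh≡0)

  γ₂ : Carrier
  γ₂ = 1# + ζ

  γ₂^q : γ₂ ^ q ≡ 1# + ζ * h
  γ₂^q = trans (frob-q 1# ζ) (cong₂ _+_ (1^ q) ζ^q)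

  Uγ₂ : U γ₂ ≡ 1# + 1#
  Uγ₂ = begin
      (1# + ζ) + γ₂ ^ q               ≡⟨ cong ((1# + ζ) +_) γ₂^q ⟩
      (1# + ζ) + (1# + ζ * h)
        ≡⟨ solve 2 (λ z h → (con 1 :+ z) :+ (con 1 :+ z :* h) := (con 1 :+ con 1) :+ (z :+ z :* h)) refl ζ h ⟩
      (1# + 1#) + (ζ + ζ * h)         ≡⟨ cong ((1# + 1#) +_) ζ+ζh≡0 ⟩
      (1# + 1#) + 0#                  ≡⟨ +-identityʳ _ ⟩
      1# + 1#                         ∎

  Uγ₂ζ : U (γ₂ * ζ) ≡ (ζ * ζ) * (1# + 1#)
  Uγ₂ζ = begin
      γ₂ * ζ + (γ₂ * ζ) ^ q                    ≡⟨ cong (γ₂ * ζ +_) (*-^ γ₂ ζ q) ⟩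
      γ₂ * ζ + γ₂ ^ q * ζ ^ q                  ≡⟨ cong₂ (λ x y → γ₂ * ζ + x * y) γ₂^q ζ^q ⟩
      (1# + ζ) * ζ + (1# + ζ * h) * (ζ * h)
        ≡⟨ solve 2 (λ z h → (con 1 :+ z) :* z :+ (con 1 :+ z :* h) :* (z :* h)
                         := z :* (con 1 :+ h) :+ (z :* z) :* (con 1 :+ h :* h)) refl ζ h ⟩
      ζ * (1# + h) + (ζ * ζ) * (1# + h * h)    ≡⟨ cong₂ (λ x y → ζ * x + (ζ * ζ) * (1# + y)) 1+h≡0 h*h≡1 ⟩
      ζ * 0# + (ζ * ζ) * (1# + 1#)             ≡⟨ trans (cong (_+ (ζ * ζ) * (1# + 1#)) (zeroʳ ζ)) (+-identityˡ _) ⟩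
      (ζ * ζ) * (1# + 1#)                      ∎

  weight-γ₂ : weight F n (cw γ₂) ≡ c ℕ.+ c
  weight-γ₂ = trans (weight-decomposition γ₂) (cong₂ ℕ._+_
    (B-const _ (U-fixed γ₂) (λ Uγ₂≡0 → 2≢0 (trans (sym Uγ₂) Uγ₂≡0)))
    (B-const _ (U-fixed (γ₂ * ζ)) (λ U≡0 → ζζ2≢0 (trans (sym Uγ₂ζ) U≡0))))
    where
    ζζ2≢0 : (ζ * ζ) * (1# + 1#) ≢ 0#
    ζζ2≢0 = *-≢0 (*-≢0 (ω^≢0 k) (ω^≢0 k)) 2≢0

-- The statement uses the unqualified arithmetic of Data.Nat, which would clash with the
-- field operations inside the modules above.
open import Data.Nat using (_+_; _*_; _^_; _<_)

corollary3p3 : (p a : ℕ) → Prime p → p ≢ 2 → 0 < a →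
    (F : Field) → HasSize F ((p ^ a) ^ 2) →
    (ω : Field.Carrier F) → IsPrimitive F ((p ^ a) ^ 2) ω →
    (k n : ℕ) → 2 * k ≡ p ^ a + 1 → k * n ≡ (p ^ a) ^ 2 ∸ 1 →
    IsTwoWeight F n (codeword F p (2 * a) ω k n)
corollary3p3 p a pp p≢2 0<a F size ω prim k n 2k≡q+1 kn≡Q-1 =
  twoWeight-intro n cw c c≢0 weights (Field.1# F) γ₂ weight-1 weight-γ₂
  where
  open Corollary p a pp p≢2 0<a F size ω prim k n 2k≡q+1 kn≡Q-1
  open NonzeroCount F using (twoWeight-intro)
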